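{- For all formulas $A,B$ of $\mathcal{L}(\forall,\Box)$ and every variable $x$, the following formulas belong to $\mathsf{FOL\Box}$: (1a) $\Box(A\vee\Box B)\leftrightarrow(\Box A\vee\Box B)$; (1b) $(\exists x\Box A\leftrightarrow\forall x\Box A)$ and $(\forall x\Box A\leftrightarrow\Box A)$; (1c) $(\exists x\Diamond A\leftrightarrow\forall x\Diamond A)$ and $(\forall x\Diamond A\leftrightarrow\Diamond A)$; (1d) $\forall x(A\vee\Box B)\leftrightarrow(\forall xA\vee\Box B)$.
   Context: Language $\mathcal{L}(\forall,\Box)$: first-order language with identity $=$, predicate symbols, variables, no constants or function symbols, connectives $\neg,\to$, quantifier $\forall$, modal operator $\Box$ (arbitrary nesting); other connectives defined as usual, $\exists x:=\neg\forall x\neg$, $\Diamond:=\neg\Box\neg$. A formula is $\Box$-free if it contains no $\Box$. $\mathsf{FOL}$ is the set of $\Box$-free theses of classical first-order logic with identity. An occurrence of $x$ in $A$ is $\forall\Box$-bound if it is in the scope of a quantifier on $x$ or inside the scope of some $\Box$; otherwise $\forall\Box$-free. $x$ is a $\forall\Box$-free variable of $A$ if it has a $\forall\Box$-free occurrence. $A(^y/_x)$ is the simultaneous replacement of every $\forall\Box$-free occurrence of $x$ by $y$, provided $y$ is not captured by a quantifier. $\mathsf{FOL\Box}$ is the smallest set of formulas containing all instances of propositional tautologies and all instances of: $\Box(A\to B)\to(\Box A\to\Box B)$; $\Box A\to A$; $\neg\Box A\to\Box\neg\Box A$; $\forall xA\to A(^y/_x)$ (admissible $\forall\Box$-free substitution);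 $\forall x(A\to B)\to(A\to\forall xB)$ if $x$ is not $\forall\Box$-free in $A$; $x=x$; $x=y\wedge A(x)\to A(y)$ for $\Box$-free $A$ (usual first-order identity axiom); $\Box A\to\forall xA$; $\neg\Box A$ for every $\Box$-free $A\notin\mathsf{FOL}$; closed under: $A\in\mathsf{FOL\Box}\Rightarrow\Box A\in\mathsf{FOL\Box}$, and modus ponens. -}

module Defs where

open import Data.Nat using (ℕ; _≟_)
open import Data.Bool using (Bool; true; false; not; _∨_; if_then_else_)
open import Data.List using (List; map)
open import Data.List.Membership.Propositional using (_∈_)
open import Data.Product using (_×_)
open import Data.Sum using (_⊎_)
open import Relation.Nullary using (¬_; does)
open import Relation.Binary.PropositionalEquality using (_≡_; _≢_)

Var : Set
Var = ℕ

data Fm : Set where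
  atom : (P : ℕ) → List Var → Fm
  _≐_  : Var → Var → Fm
  ~_   : Fm → Fm
  _⇒_  : Fm → Fm → Fm
  ∀'   : Var → Fm → Fm
  □_   : Fm → Fm

infixr 4 _⇒_
infix  15 _≐_
infixr 6 _∧'_
infixr 5 _∨'_
infix 3 _⇔_

_∨'_ : Fm → Fm → Fm
A ∨' B = (~ A) ⇒ B

_∧'_ : Fm → Fm → Fm
A ∧' B = ~ (A ⇒ ~ B)

_⇔_ : Fm → Fm → Fm
A ⇔ B = (A ⇒ B) ∧' (B ⇒ A)

∃' : Var → Fm → Fm
∃' x A = ~ ∀' x (~ A)

◇_ : Fm → Fm
◇ A = ~ □ ~ A

data BoxFree : Fm → Set where
  atom : ∀ P vs → BoxFree (atom P vs)
  eq   : ∀ x y → BoxFree (x ≐ y)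
  neg  : ∀ {A} → BoxFree A → BoxFree (~ A)
  imp  : ∀ {A B} → BoxFree A → BoxFree B → BoxFree (A ⇒ B)
  all  : ∀ {x A} → BoxFree A → BoxFree (∀' x A)

data FreeIn (x : Var) : Fm → Set where
  atom : ∀ {P vs} → x ∈ vs → FreeIn x (atom P vs)
  eqˡ  : ∀ {y} → FreeIn x (x ≐ y)
  eqʳ  : ∀ {y} → FreeIn x (y ≐ x)
  neg  : ∀ {A} → FreeIn x A → FreeIn x (~ A)
  impˡ : ∀ {A B} → FreeIn x A → FreeIn x (A ⇒ B)
  impʳ : ∀ {A B} → FreeIn x B → FreeIn x (A ⇒ B)
  all  : ∀ {z A} → z ≢ x → FreeIn x A → FreeIn x (∀' z A)
  -- no clause for □: occurrences inside □ are ∀□-bound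

-- Admissible substitution: Sub x y A A' means A' is A(y/x), i.e. every
-- ∀□-free occurrence of x replaced by y, and no replaced occurrence is
-- captured by a quantifier on y.

rename : Var → Var → Var → Var
rename x y v = if does (v ≟ x) then y else v

data Sub (x y : Var) : Fm → Fm → Set where
  atom : ∀ P vs → Sub x y (atom P vs) (atom P (map (rename x y) vs))
  eq   : ∀ u v → Sub x y (u ≐ v) (rename x y u ≐ rename x y v)
  neg  : ∀ {A A'} → Sub x y A A' → Sub x y (~ A) (~ A')
  imp  : ∀ {A A' B B'} → Sub x y A A' → Sub x y B B' → Sub x y (A ⇒ B) (A' ⇒ B')
  box  : ∀ A → Sub x y (□ A) (□ A)
  allˢ : ∀ A → Sub x y (∀' x A) (∀' x A)
  allᵛ : ∀ {z A} → z ≢ x → ¬ FreeIn x A → Sub x y (∀' z A) (∀' z A)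
  all  : ∀ {z A A'} → z ≢ x → z ≢ y → Sub x y A A' → Sub x y (∀' z A) (∀' z A')

-- Instances of propositional tautologies: prime formulas (atoms,
-- identities, ∀-formulas, □-formulas) are treated as propositional letters.

eval : (Fm → Bool) → Fm → Bool
eval v (~ A)   = not (eval v A)
eval v (A ⇒ B) = not (eval v A) ∨ eval v B
eval v A       = v A

Taut : Fm → Set
Taut A = (v : Fm → Bool) → eval v A ≡ true

data FOL : Fm → Set where
  taut  : ∀ {A} → BoxFree A → Taut A → FOL A
  inst  : ∀ {x y A A'} → BoxFree A → Sub x y A A' → FOL (∀' x A ⇒ A')
  dist  : ∀ {x A B} → BoxFree A → BoxFree B → ¬ FreeIn x A →
          FOL (∀' x (A ⇒ B) ⇒ (A ⇒ ∀' x B))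
  refl≐ : ∀ x → FOL (x ≐ x)
  leib  : ∀ {x y A A'} → BoxFree A → Sub x y A A' →
          FOL ((x ≐ y ∧' A) ⇒ A')
  mp    : ∀ {A B} → FOL (A ⇒ B) → FOL A → FOL B
  gen   : ∀ {A} x → FOL A → FOL (∀' x A)

data FOL□ : Fm → Set where
  taut   : ∀ {A} → Taut A → FOL□ A
  K      : ∀ A B → FOL□ (□ (A ⇒ B) ⇒ (□ A ⇒ □ B))
  T      : ∀ A → FOL□ (□ A ⇒ A)
  five   : ∀ A → FOL□ (~ □ A ⇒ □ (~ □ A))
  inst   : ∀ {x y A A'} → Sub x y A A' → FOL□ (∀' x A ⇒ A')
  dist   : ∀ {x A B} → ¬ FreeIn x A → FOL□ (∀' x (A ⇒ B) ⇒ (A ⇒ ∀' x B))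
  refl≐  : ∀ x → FOL□ (x ≐ x)
  leib   : ∀ {x y A A'} → BoxFree A → Sub x y A A' →
           FOL□ ((x ≐ y ∧' A) ⇒ A')
  box∀   : ∀ x A → FOL□ (□ A ⇒ ∀' x A)
  nonFOL : ∀ {A} → BoxFree A → ¬ FOL A → FOL□ (~ □ A)
  nec    : ∀ {A} → FOL□ A → FOL□ (□ A)
  mp     : ∀ {A B} → FOL□ (A ⇒ B) → FOL□ A → FOL□ B

-- Both □ and ∀ x behave as normal modalities M, and a normal modality commutes
-- with any disjunct C it cannot change (⊢ C ⇒ M C and ⊢ ~ C ⇒ M (~ C)):
-- M (A ∨ C) ⇔ M A ∨ C. For ∀ x these C include every formula without ∀□-free
-- x, in particular □ B and ◇ A, which also gives (1b) and (1c); for □, the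
-- formula □ B qualifies by axiom 5 and by axiom 4, derived from T and 5.
module Submission where

open import Data.Bool using (Bool; true; false; not; _∨_; _∧_) renaming (T to True)
open import Data.Bool.Properties using (T-∧; T-≡)
open import Data.Fin using (Fin; zero; suc)
open import Data.List using (map)
open import Data.List.Properties using (map-cong; map-id)
open import Data.Nat using (ℕ; zero; suc; _+_; _≡ᵇ_; _≟_)
open import Data.Nat.Properties using (≡ᵇ⇒≡)
open import Data.Product using (_×_; _,_; proj₁; proj₂)
open import Data.Vec using (Vec; []; _∷_; lookup) renaming (map to mapᵥ)
open import Data.Vec.Properties using (lookup-map)
open import Function using (_∘_)
open import Function.Bundles using (Equivalence)
open import Relation.Nullary using (¬_; yes; no)
open import Relation.Binary.PropositionalEquality
  using (_≡_; refl; sym; cong; cong₂; trans; subst)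

open import Defs

private
  variable
    n : ℕ
    x : Var
    A C P Q R S : Fm

infixr 4 _⇒_
infixr 5 _∨ₚ_
infix 3 _⇔ₚ_

-- Propositional schemas in n letters; the constructors overload those of Fm so
-- that a schema reads like the formula it is instantiated to.
data Schema (n : ℕ) : Set where
  var : Fin n → Schema n
  ~_  : Schema n → Schema n
  _⇒_ : Schema n → Schema n → Schema n

_∨ₚ_ _⇔ₚ_ : Schema n → Schema n → Schema n
φ ∨ₚ ψ = ~ φ ⇒ ψ
φ ⇔ₚ ψ = ~ ((φ ⇒ ψ) ⇒ ~ (ψ ⇒ φ))

p : Schema (1 + n)
p = var zero

q : Schema (2 + n)
q = var (suc zero)

r : Schema (3 + n)
r = var (suc (suc zero))

s : Schema (4 + n)
s = var (suc (suc (suc zero)))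

_⟦_⟧ : Schema n → Vec Fm n → Fm
var i   ⟦ σ ⟧ = lookup σ i
(~ φ)   ⟦ σ ⟧ = ~ (φ ⟦ σ ⟧)
(φ ⇒ ψ) ⟦ σ ⟧ = φ ⟦ σ ⟧ ⇒ ψ ⟦ σ ⟧

evalₚ : Vec Bool n → Schema n → Bool
evalₚ ρ (var i) = lookup ρ i
evalₚ ρ (~ φ)   = not (evalₚ ρ φ)
evalₚ ρ (φ ⇒ ψ) = not (evalₚ ρ φ) ∨ evalₚ ρ ψ

eval-⟦⟧ : (v : Fm → Bool) (φ : Schema n) (σ : Vec Fm n) →
          eval v (φ ⟦ σ ⟧) ≡ evalₚ (mapᵥ (eval v) σ) φ
eval-⟦⟧ v (var i) σ = sym (lookup-map i (eval v) σ)
eval-⟦⟧ v (~ φ)   σ = cong not (eval-⟦⟧ v φ σ)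
eval-⟦⟧ v (φ ⇒ ψ) σ = cong₂ (λ a b → not a ∨ b) (eval-⟦⟧ v φ σ) (eval-⟦⟧ v ψ σ)

all? : ∀ n → (Vec Bool n → Bool) → Bool
all? zero    f = f []
all? (suc n) f = all? n (f ∘ (true ∷_)) ∧ all? n (f ∘ (false ∷_))

all?-sound : ∀ n (f : Vec Bool n → Bool) → True (all? n f) → ∀ ρ → True (f ρ)
all?-sound zero    f h []          = h
all?-sound (suc n) f h (true ∷ ρ)  = all?-sound n _ (proj₁ (Equivalence.to T-∧ h)) ρ
all?-sound (suc n) f h (false ∷ ρ) = all?-sound n _ (proj₂ (Equivalence.to T-∧ h)) ρ

isTautology : Schema n → Bool
isTautology {n} φ = all? n (λ ρ → evalₚ ρ φ)

-- For a closed schema the validity argument normalises to ⊤ and is inferred.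
tautology : (φ : Schema n) {_ : True (isTautology φ)} (σ : Vec Fm n) → FOL□ (φ ⟦ σ ⟧)
tautology {n} φ {valid} σ = taut λ v → trans (eval-⟦⟧ v φ σ)
  (Equivalence.to T-≡ (all?-sound n (λ ρ → evalₚ ρ φ) valid (mapᵥ (eval v) σ)))

mp₂ : FOL□ (P ⇒ Q ⇒ R) → FOL□ P → FOL□ Q → FOL□ R
mp₂ h a b = mp (mp h a) b

⇒-refl : FOL□ (P ⇒ P)
⇒-refl {P} = tautology (p ⇒ p) (P ∷ [])

⇒-trans : FOL□ (P ⇒ Q) → FOL□ (Q ⇒ R) → FOL□ (P ⇒ R)
⇒-trans {P} {Q} {R} = mp₂ (tautology ((p ⇒ q) ⇒ (q ⇒ r) ⇒ p ⇒ r) (P ∷ Q ∷ R ∷ []))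

⇒-precompose : FOL□ (P ⇒ Q ⇒ R) → FOL□ (S ⇒ Q) → FOL□ (P ⇒ S ⇒ R)
⇒-precompose {P} {Q} {R} {S} =
  mp₂ (tautology ((p ⇒ q ⇒ r) ⇒ (s ⇒ q) ⇒ p ⇒ s ⇒ r) (P ∷ Q ∷ R ∷ S ∷ []))

⇔-intro : FOL□ (P ⇒ Q) → FOL□ (Q ⇒ P) → FOL□ (P ⇔ Q)
⇔-intro {P} {Q} = mp₂ (tautology ((p ⇒ q) ⇒ (q ⇒ p) ⇒ (p ⇔ₚ q)) (P ∷ Q ∷ []))

∨-comm : FOL□ (P ∨' Q ⇒ Q ∨' P)
∨-comm {P} {Q} = tautology (p ∨ₚ q ⇒ q ∨ₚ p) (P ∷ Q ∷ [])

∨-introˡ : FOL□ (P ⇒ P ∨' Q)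
∨-introˡ {P} {Q} = tautology (p ⇒ p ∨ₚ q) (P ∷ Q ∷ [])

∨-introʳ : FOL□ (Q ⇒ P ∨' Q)
∨-introʳ {Q} {P} = tautology (q ⇒ p ∨ₚ q) (P ∷ Q ∷ [])

∨-elim : FOL□ (P ⇒ R) → FOL□ (Q ⇒ R) → FOL□ (P ∨' Q ⇒ R)
∨-elim {P} {R} {Q} = mp₂ (tautology ((p ⇒ r) ⇒ (q ⇒ r) ⇒ p ∨ₚ q ⇒ r) (P ∷ Q ∷ R ∷ []))

contraposeˡ : FOL□ (~ P ⇒ Q) → FOL□ (~ Q ⇒ P)
contraposeˡ = mp ∨-comm

contraposeʳ : FOL□ (P ⇒ ~ Q) → FOL□ (Q ⇒ ~ P)
contraposeʳ {P} {Q} = mp (tautology ((p ⇒ ~ q) ⇒ q ⇒ ~ p) (P ∷ Q ∷ []))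

record IsNormal (M : Fm → Fm) : Set where
  field
    necessitation : FOL□ P → FOL□ (M P)
    distribution  : FOL□ (M (P ⇒ Q) ⇒ M P ⇒ M Q)

  monotone : FOL□ (P ⇒ Q) → FOL□ (M P ⇒ M Q)
  monotone h = mp distribution (necessitation h)

distrib-∨-stable : ∀ {M} → IsNormal M →
                   FOL□ (C ⇒ M C) → FOL□ (~ C ⇒ M (~ C)) →
                   FOL□ (M (A ∨' C) ⇔ (M A ∨' C))
distrib-∨-stable normal C⇒MC ¬C⇒M¬C = ⇔-intro
  (⇒-trans (⇒-precompose (⇒-trans (monotone ∨-comm) distribution) ¬C⇒M¬C) ∨-comm)
  (∨-elim (monotone ∨-introˡ) (⇒-trans C⇒MC (monotone ∨-introʳ)))
  where open IsNormal normal

□-isNormal : IsNormal □_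
□-isNormal = record { necessitation = nec ; distribution = K _ _ }

□-4 : FOL□ (□ P ⇒ □ □ P)
□-4 {P} = ⇒-trans (contraposeʳ (T (~ □ P)))
         (⇒-trans (five (~ □ P)) (IsNormal.monotone □-isNormal (contraposeˡ (five P))))

rename-refl : ∀ x v → rename x x v ≡ v
rename-refl x v with v ≡ᵇ x in v≡ᵇx
... | true  = sym (≡ᵇ⇒≡ v x (subst True (sym v≡ᵇx) _))
... | false = refl

Sub-refl : ∀ x A → Sub x x A A
Sub-refl x (atom P vs) =
  subst (Sub x x (atom P vs)) (cong (atom P) (trans (map-cong (rename-refl x) vs) (map-id vs)))
        (atom P vs)
Sub-refl x (u ≐ v) =
  subst (Sub x x (u ≐ v)) (cong₂ _≐_ (rename-refl x u) (rename-refl x v)) (eq u v)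
Sub-refl x (~ A)    = neg (Sub-refl x A)
Sub-refl x (A ⇒ B)  = imp (Sub-refl x A) (Sub-refl x B)
Sub-refl x (□ A)    = box A
Sub-refl x (∀' z A) with z ≟ x
... | yes refl = allˢ A
... | no z≢x   = all z≢x z≢x (Sub-refl x A)

∀-elim : FOL□ (∀' x P ⇒ P)
∀-elim {x} {P} = inst (Sub-refl x P)

-- Generalisation is not primitive in FOL□; it goes through □.
generalise : FOL□ P → FOL□ (∀' x P)
generalise {P} {x} h = mp (box∀ x P) (nec h)

∀-intro : ¬ FreeIn x P → FOL□ (P ⇒ Q) → FOL□ (P ⇒ ∀' x Q)
∀-intro x∉P h = mp (dist x∉P) (generalise h)

∀-bound : ¬ FreeIn x (∀' x P)
∀-bound (all x≢x _) = x≢x refl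

□-bound : ¬ FreeIn x (□ P)
□-bound ()

~-bound : ¬ FreeIn x P → ¬ FreeIn x (~ P)
~-bound x∉P (neg x∈P) = x∉P x∈P

∀-isNormal : ∀ x → IsNormal (∀' x)
∀-isNormal x = record
  { necessitation = generalise
  ; distribution  = ⇒-trans (∀-intro ∀-bound (⇒-precompose ∀-elim ∀-elim)) (dist ∀-bound)
  }

∀-vacuous-intro : ¬ FreeIn x C → FOL□ (C ⇒ ∀' x C)
∀-vacuous-intro x∉C = ∀-intro x∉C ⇒-refl

∀-vacuous : ¬ FreeIn x C → FOL□ (∀' x C ⇔ C)
∀-vacuous x∉C = ⇔-intro ∀-elim (∀-vacuous-intro x∉C)

∃⇔∀-vacuous : ¬ FreeIn x C → FOL□ (∃' x C ⇔ ∀' x C)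
∃⇔∀-vacuous x∉C = ⇔-intro
  (⇒-trans (contraposeˡ (∀-vacuous-intro (~-bound x∉C))) (∀-vacuous-intro x∉C))
  (⇒-trans ∀-elim (contraposeʳ ∀-elim))

lemma4 : (A B : Fm) (x : Var) →
    FOL□ (□ (A ∨' □ B) ⇔ (□ A ∨' □ B))
    × (FOL□ (∃' x (□ A) ⇔ ∀' x (□ A)) × FOL□ (∀' x (□ A) ⇔ □ A))
    × (FOL□ (∃' x (◇ A) ⇔ ∀' x (◇ A)) × FOL□ (∀' x (◇ A) ⇔ ◇ A))
    × FOL□ (∀' x (A ∨' □ B) ⇔ (∀' x A ∨' □ B))
lemma4 A B x =
    distrib-∨-stable □-isNormal □-4 (five B)
  , (∃⇔∀-vacuous □-bound , ∀-vacuous □-bound)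
  , (∃⇔∀-vacuous ◇-bound , ∀-vacuous ◇-bound)
  , distrib-∨-stable (∀-isNormal x) (∀-vacuous-intro □-bound) (∀-vacuous-intro ◇-bound)
  where
  ◇-bound : ∀ {C} → ¬ FreeIn x (~ □ C)
  ◇-bound = ~-bound □-bound
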